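{- Let $A$ and $B$ be finite non-empty subsets of $\mathbb{N}=\{1,2,3,\dots\}$, and let $n\in\mathbb{N}$. Let $G$ be the disjoint union of the digraphs $\vec D_a$ for $a\in A$, and let $H$ be the disjoint union of the digraphs $\vec D_b$ for $b\in B$. Then there is a $\mathbb{Z}_n$-flow-continuous mapping $E(G)\to E(H)$ if and only if $A$ is a subset of the integer cone of $B\cup\{n\}$.
   Context: Digraphs are finite multidigraphs; loops and parallel edges are allowed. For $m\in\mathbb{N}$, $\vec D_m$ denotes the digraph with two vertices and $m$ parallel edges, all oriented in the same direction. For an abelian group $M$, a map $\varphi:E(G)\to M$ is an $M$-flow if at every vertex $v$ the sum of $\varphi$ over edges leaving $v$ equals the sum of $\varphi$ over edges entering $v$. A mapping $f:E(G)\to E(H)$ is $M$-flow-continuous if for every $M$-flow $\varphi$ on $H$ the composition $\varphi\circ f$ is an $M$-flow on $G$. The integer cone of a finite set $\{s_1,\dots,s_t\}\subseteq\mathbb{N}$ is $\{\sum_{i=1}^t a_is_i: a_i\in\mathbb{Z},\ a_i\ge 0\}$. -}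

module Defs where

open import Level using (0ℓ)
open import Data.Nat as ℕ using (ℕ; zero; suc; _≤_)
open import Data.Integer as ℤ using (ℤ; +_; _-_; -_)
open import Data.Integer.Properties as ℤP using ()
open import Data.Integer.Solver using (module +-*-Solver)
open import Data.Fin as Fin using (Fin; _↑ˡ_; _↑ʳ_; splitAt)
open import Data.Sum using ([_,_])
open import Data.Product using (Σ; ∃; ∃-syntax; _×_; _,_)
open import Data.List as List using (List; []; _∷_; length; zipWith)
open import Data.Nat.ListAction using (sum)
open import Data.List.Relation.Unary.All using (All)
open import Data.Bool using (if_then_else_)
open import Relation.Nullary.Decidable using (⌊_⌋)
open import Relation.Binary.PropositionalEquality
  using (_≡_; refl; sym; trans; cong; cong₂)
open import Algebra.Bundles using (AbelianGroup)
open import Algebra.Structures using (IsAbelianGroup)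

record Digraph : Set where
  field
    V   : ℕ
    E   : ℕ
    src : Fin E → Fin V
    tgt : Fin E → Fin V
open Digraph public

D⃗ : ℕ → Digraph
D⃗ m = record { V = 2 ; E = m ; src = λ _ → Fin.zero ; tgt = λ _ → Fin.suc Fin.zero }

∅G : Digraph
∅G = record { V = 0 ; E = 0 ; src = λ () ; tgt = λ () }

_⊕_ : Digraph → Digraph → Digraph
G ⊕ H = record
  { V   = V G ℕ.+ V H
  ; E   = E G ℕ.+ E H
  ; src = λ e → [ (λ e₁ → src G e₁ ↑ˡ V H) , (λ e₂ → V G ↑ʳ src H e₂) ] (splitAt (E G) e)
  ; tgt = λ e → [ (λ e₁ → tgt G e₁ ↑ˡ V H) , (λ e₂ → V G ↑ʳ tgt H e₂) ] (splitAt (E G) e)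
  }

-- Disjoint union of the digraphs D⃗ a, a ∈ A (A given as a list of distinct elements).
⨁D⃗ : List ℕ → Digraph
⨁D⃗ A = List.foldr (λ a G → D⃗ a ⊕ G) ∅G A

module _ (M : AbelianGroup 0ℓ 0ℓ) where
  open AbelianGroup M renaming (Carrier to |M|)

  Σᴹ : ∀ {k} → (Fin k → |M|) → |M|
  Σᴹ {zero}  f = ε
  Σᴹ {suc k} f = f Fin.zero ∙ Σᴹ (λ i → f (Fin.suc i))

  outSum inSum : (G : Digraph) → (Fin (E G) → |M|) → Fin (V G) → |M|
  outSum G φ v = Σᴹ (λ e → if ⌊ src G e Fin.≟ v ⌋ then φ e else ε)
  inSum  G φ v = Σᴹ (λ e → if ⌊ tgt G e Fin.≟ v ⌋ then φ e else ε)

  IsFlow : (G : Digraph) → (Fin (E G) → |M|) → Set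
  IsFlow G φ = ∀ v → outSum G φ v ≈ inSum G φ v

  FlowContinuous : (G H : Digraph) → (Fin (E G) → Fin (E H)) → Set
  FlowContinuous G H f = ∀ (φ : Fin (E H) → |M|) → IsFlow H φ → IsFlow G (λ e → φ (f e))

-- The cyclic group ℤₙ = ℤ/nℤ, as ℤ with equality "congruent modulo n".

module _ (n : ℕ) where
  _≡ₙ_ : ℤ → ℤ → Set
  x ≡ₙ y = ∃[ k ] (x - y ≡ k ℤ.* + n)

  private
    open +-*-Solver

    ≡⇒≡ₙ : ∀ {x y} → x ≡ y → x ≡ₙ y
    ≡⇒≡ₙ {x} refl = + 0 , trans (ℤP.+-inverseʳ x) refl

    sym' : ∀ {x y} → x ≡ₙ y → y ≡ₙ x
    sym' {x} {y} (k , p) = - k , (begin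
        y - x          ≡⟨ solve 2 (λ x y → y :- x := :- (x :- y)) refl x y ⟩
        - (x - y)      ≡⟨ cong -_ p ⟩
        - (k ℤ.* + n)  ≡⟨ ℤP.neg-distribˡ-* k (+ n) ⟩
        - k ℤ.* + n    ∎)
      where open Relation.Binary.PropositionalEquality.≡-Reasoning

    trans' : ∀ {x y z} → x ≡ₙ y → y ≡ₙ z → x ≡ₙ z
    trans' {x} {y} {z} (k , p) (l , q) = k ℤ.+ l , (begin
        x - z                      ≡⟨ solve 3 (λ x y z → x :- z := (x :- y) :+ (y :- z)) refl x y z ⟩
        (x - y) ℤ.+ (y - z)        ≡⟨ cong₂ ℤ._+_ p q ⟩
        k ℤ.* + n ℤ.+ l ℤ.* + n    ≡⟨ sym (ℤP.*-distribʳ-+ (+ n) k l) ⟩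
        (k ℤ.+ l) ℤ.* + n          ∎)
      where open Relation.Binary.PropositionalEquality.≡-Reasoning

    +-cong' : ∀ {x y u v} → x ≡ₙ y → u ≡ₙ v → (x ℤ.+ u) ≡ₙ (y ℤ.+ v)
    +-cong' {x} {y} {u} {v} (k , p) (l , q) = k ℤ.+ l , (begin
        (x ℤ.+ u) - (y ℤ.+ v)      ≡⟨ solve 4 (λ x y u v → (x :+ u) :- (y :+ v) := (x :- y) :+ (u :- v)) refl x y u v ⟩
        (x - y) ℤ.+ (u - v)        ≡⟨ cong₂ ℤ._+_ p q ⟩
        k ℤ.* + n ℤ.+ l ℤ.* + n    ≡⟨ sym (ℤP.*-distribʳ-+ (+ n) k l) ⟩
        (k ℤ.+ l) ℤ.* + n          ∎)
      where open Relation.Binary.PropositionalEquality.≡-Reasoning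

    neg-cong' : ∀ {x y} → x ≡ₙ y → (- x) ≡ₙ (- y)
    neg-cong' {x} {y} (k , p) = - k , (begin
        - x - - y      ≡⟨ solve 2 (λ x y → :- x :- :- y := :- (x :- y)) refl x y ⟩
        - (x - y)      ≡⟨ cong -_ p ⟩
        - (k ℤ.* + n)  ≡⟨ ℤP.neg-distribˡ-* k (+ n) ⟩
        - k ℤ.* + n    ∎)
      where open Relation.Binary.PropositionalEquality.≡-Reasoning

  ℤ/ : AbelianGroup 0ℓ 0ℓ
  ℤ/ = record
    { Carrier = ℤ
    ; _≈_ = _≡ₙ_
    ; _∙_ = ℤ._+_
    ; ε = + 0
    ; _⁻¹ = -_
    ; isAbelianGroup = record
      { isGroup = record
        { isMonoid = record
          { isSemigroup = record
            { isMagma = record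
              { isEquivalence = record { refl = λ {x} → ≡⇒≡ₙ {x} {x} refl ; sym = λ {x} {y} → sym' {x} {y} ; trans = λ {x} {y} {z} → trans' {x} {y} {z} }
              ; ∙-cong = λ {x} {y} {u} {v} → +-cong' {x} {y} {u} {v} }
            ; assoc = λ x y z → ≡⇒≡ₙ (ℤP.+-assoc x y z) }
          ; identity = (λ x → ≡⇒≡ₙ (ℤP.+-identityˡ x)) , (λ x → ≡⇒≡ₙ (ℤP.+-identityʳ x)) }
        ; inverse = (λ x → ≡⇒≡ₙ (ℤP.+-inverseˡ x)) , (λ x → ≡⇒≡ₙ (ℤP.+-inverseʳ x))
        ; ⁻¹-cong = λ {x} {y} → neg-cong' {x} {y} }
      ; comm = λ x y → ≡⇒≡ₙ (ℤP.+-comm x y) }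
    }

InIntegerCone : List ℕ → ℕ → Set
InIntegerCone S x = ∃[ a ] (length a ≡ length S × x ≡ sum (zipWith ℕ._*_ a S))

module Submission where

-- A ℤₙ-flow on a disjoint union of digraphs D⃗ b is exactly an edge labelling whose sum over each
-- block of parallel edges vanishes, and a map out of ⨁D⃗ A is flow-continuous iff its restriction
-- to every block D⃗ a is.  So everything hinges on maps g from the a edges of D⃗ a to the edges of
-- H = ⨁D⃗ B, and g is flow-continuous iff every flow φ of H has Σᵢ φ(g i) = Σₑ |g⁻¹ e| φ e ≡ 0.
-- Testing this against φ = δᵢ − δⱼ for two edges i, j of one block D⃗ b shows that the fibre sizes
-- |g⁻¹ e| are constant modulo n on each block, so a = Σₑ |g⁻¹ e| lies in nℕ + Σ_{b ∈ B} bℕ.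
-- Conversely, n copies of a single edge and the b edges of a block are flow-continuous, and
-- flow-continuous maps out of D⃗ a and D⃗ a′ concatenate to one out of D⃗ (a + a′).

open import Defs
open import Level using (0ℓ)
open import Algebra.Bundles using (Monoid; CommutativeMonoid; AbelianGroup)
open import Data.Bool using (false; if_then_else_)
open import Data.Bool.Properties using (if-eta)
open import Data.Empty using (⊥-elim)
open import Data.Fin using (Fin; zero; suc; _↑ˡ_; _↑ʳ_; splitAt; _≟_)
open import Data.Fin.Properties
  using (suc-injective; ↑ˡ-injective; ↑ʳ-injective; splitAt-↑ˡ; splitAt-↑ʳ; splitAt⁻¹-↑ˡ; splitAt⁻¹-↑ʳ)
open import Data.Integer as ℤ using (ℤ; +_; -[1+_])
import Data.Integer.Properties as ℤP
open import Data.Integer.Solver using (module +-*-Solver)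
open import Data.List using (List; []; _∷_)
open import Data.List.Relation.Unary.All as All using (All; []; _∷_)
open import Data.List.Relation.Unary.Unique.Propositional using (Unique)
open import Data.Nat as ℕ using (ℕ; zero; suc; _≤_; s≤s; z≤n)
open import Data.Nat.DivMod using (_%_; _/_; m≡m%n+[m/n]*n; [m+kn]%n≡m%n)
import Data.Nat.Properties as ℕP
import Data.Nat.Solver as ℕSolver
open import Data.Product using (Σ; _×_; _,_; proj₁; proj₂)
open import Data.Sum using (inj₁; inj₂; [_,_])
open import Data.Vec.Functional using (Vector; tail; take; drop; _++_)
open import Data.Vec.Functional.Properties using (lookup-++ˡ; lookup-++ʳ)
open import Function using (_∘_; Injective)
open import Function.Bundles using (_⇔_; mk⇔; module Equivalence)
open import Function.Construct.Composition using (_⇔-∘_)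
open import Relation.Nullary.Decidable using (⌊_⌋; isYes≗does; does-⇔; dec-false)
open import Relation.Binary.PropositionalEquality as ≡
  using (_≡_; _≢_; _≗_; refl; cong; cong₂; subst; module ≡-Reasoning)

open Equivalence using (to; from)

⌊≟⌋-injective : ∀ {m n} {f : Fin m → Fin n} → Injective _≡_ _≡_ f →
                ∀ x y → ⌊ f x ≟ f y ⌋ ≡ ⌊ x ≟ y ⌋
⌊≟⌋-injective {f = f} f-inj x y = begin
  ⌊ f x ≟ f y ⌋  ≡⟨ isYes≗does (f x ≟ f y) ⟩
  _              ≡⟨ does-⇔ (mk⇔ f-inj (cong f)) (f x ≟ f y) (x ≟ y) ⟩
  _              ≡⟨ isYes≗does (x ≟ y) ⟨
  ⌊ x ≟ y ⌋      ∎
  where open ≡-Reasoning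

⌊≟⌋-≢ : ∀ {m} {x y : Fin m} → x ≢ y → ⌊ x ≟ y ⌋ ≡ false
⌊≟⌋-≢ {x = x} {y} x≢y = ≡.trans (isYes≗does (x ≟ y)) (dec-false (x ≟ y) x≢y)

↑ˡ≢↑ʳ : ∀ {m n} (i : Fin m) (j : Fin n) → i ↑ˡ n ≢ m ↑ʳ j
↑ˡ≢↑ʳ {m} {n} i j eq
  with () ← ≡.trans (≡.sym (splitAt-↑ˡ m i n)) (≡.trans (cong (splitAt m) eq) (splitAt-↑ʳ m n j))

↑-elim : ∀ {m n} (P : Fin (m ℕ.+ n) → Set) →
         (∀ i → P (i ↑ˡ n)) → (∀ j → P (m ↑ʳ j)) → ∀ k → P k
↑-elim {m} P left right k with splitAt m k in eq
... | inj₁ i = subst P (splitAt⁻¹-↑ˡ eq) (left i)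
... | inj₂ j = subst P (splitAt⁻¹-↑ʳ eq) (right j)

-- Finite sums

δ : ∀ {k} → Fin k → Fin k → ℕ
δ x e = if ⌊ x ≟ e ⌋ then 1 else 0

δ-suc : ∀ {k} (x e : Fin k) → δ (suc x) (suc e) ≡ δ x e
δ-suc x e = cong (λ b → if b then 1 else 0) (⌊≟⌋-injective suc-injective x e)

module _ {c ℓ} (M : Monoid c ℓ) where
  open Monoid M renaming (refl to ≈-refl)
  open import Algebra.Properties.Monoid.Sum M using (sum; sum-cong-≗; sum-replicate-zero)
  open import Algebra.Properties.Monoid.Mult M using () renaming (_×_ to _·_)

  sum-take-drop : ∀ m {n} (f : Vector Carrier (m ℕ.+ n)) →
                  sum f ≈ sum (take m f) ∙ sum (drop m f)
  sum-take-drop zero    f = sym (identityˡ (sum f))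
  sum-take-drop (suc m) f = trans (∙-congˡ (sum-take-drop m (tail f))) (sym (assoc _ _ _))

  sum-δ-· : ∀ {k} (x : Fin k) (f : Vector Carrier k) → sum (λ e → δ x e · f e) ≈ f x
  sum-δ-· {suc k} zero    f =
    trans (∙-cong (identityʳ (f zero)) (sum-replicate-zero k)) (identityʳ (f zero))
  sum-δ-· {suc k} (suc x) f = trans (identityˡ _) (trans
    (reflexive (sum-cong-≗ (λ e → cong (_· f (suc e)) (δ-suc x e))))
    (sum-δ-· x (tail f)))

  ·-ε : ∀ m → m · ε ≈ ε
  ·-ε zero    = ≈-refl
  ·-ε (suc m) = trans (identityˡ _) (·-ε m)

open import Algebra.Properties.Monoid.Sum ℕP.+-0-monoid using ()
  renaming (sum to ∑ℕ; sum-cong-≗ to ∑ℕ-cong)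

∑ℕ-const : ∀ b r → ∑ℕ {b} (λ _ → r) ≡ b ℕ.* r
∑ℕ-const zero    r = refl
∑ℕ-const (suc b) r = cong (r ℕ.+_) (∑ℕ-const b r)

fibreSize : ∀ {a k} → (Fin a → Fin k) → Fin k → ℕ
fibreSize g e = ∑ℕ (λ i → δ (g i) e)

module _ {c ℓ} (M : CommutativeMonoid c ℓ) where
  open CommutativeMonoid M hiding (refl)
  open import Algebra.Properties.Monoid.Sum monoid using (sum; sum-cong-≋; sum-replicate-zero)
  open import Algebra.Properties.CommutativeMonoid.Sum M using (∑-distrib-+)
  open import Algebra.Properties.Monoid.Mult monoid using (×-homo-+) renaming (_×_ to _·_)
  open import Relation.Binary.Reasoning.Setoid setoid

  sum-∘-fibreSize : ∀ {a k} (φ : Vector Carrier k) (g : Fin a → Fin k) →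
                    sum (φ ∘ g) ≈ sum (λ e → fibreSize g e · φ e)
  sum-∘-fibreSize {zero}  {k} φ g = sym (sum-replicate-zero k)
  sum-∘-fibreSize {suc a}     φ g = begin
    φ (g zero) ∙ sum (φ ∘ tail g)
      ≈⟨ ∙-cong (sym (sum-δ-· monoid (g zero) φ)) (sum-∘-fibreSize φ (tail g)) ⟩
    sum (λ e → δ (g zero) e · φ e) ∙ sum (λ e → fibreSize (tail g) e · φ e)
      ≈⟨ ∑-distrib-+ (λ e → δ (g zero) e · φ e) (λ e → fibreSize (tail g) e · φ e) ⟨
    sum (λ e → δ (g zero) e · φ e ∙ fibreSize (tail g) e · φ e)
      ≈⟨ sum-cong-≋ (λ e → ×-homo-+ (φ e) (δ (g zero) e) _) ⟨
    sum (λ e → fibreSize g e · φ e)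
      ∎

sum-fibreSize : ∀ {a k} (g : Fin a → Fin k) → ∑ℕ (fibreSize g) ≡ a
sum-fibreSize {a} g = begin
  ∑ℕ (fibreSize g)              ≡⟨ ∑ℕ-cong (λ e → ·1 (fibreSize g e)) ⟨
  ∑ℕ (λ e → fibreSize g e · 1)  ≡⟨ sum-∘-fibreSize ℕP.+-0-commutativeMonoid (λ _ → 1) g ⟨
  ∑ℕ {a} (λ _ → 1)              ≡⟨ ∑ℕ-const a 1 ⟩
  a ℕ.* 1                       ≡⟨ ℕP.*-identityʳ a ⟩
  a                             ∎
  where
  open ≡-Reasoning
  open import Algebra.Properties.Monoid.Mult ℕP.+-0-monoid using () renaming (_×_ to _·_)
  ·1 : ∀ m → m · 1 ≡ m
  ·1 zero    = refl
  ·1 (suc m) = cong suc (·1 m)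

-- Integer cones

InIntegerCone-closed : {P : ℕ → Set} → P 0 → (∀ {x y} → P x → P y → P (x ℕ.+ y)) →
                       ∀ {S x} → All P S → InIntegerCone S x → P x
InIntegerCone-closed {P} P0 P+ = closed
  where
  multiple : ∀ {s} → P s → ∀ c → P (c ℕ.* s)
  multiple Ps zero    = P0
  multiple Ps (suc c) = P+ Ps (multiple Ps c)

  closed : ∀ {S x} → All P S → InIntegerCone S x → P x
  closed []        ([]     , _   , refl) = P0
  closed (Ps ∷ PS) (c ∷ cs , len , refl) =
    P+ (multiple Ps c) (closed PS (cs , ℕP.suc-injective len , refl))

InIntegerCone-insert : ∀ {s S x} t r q → InIntegerCone (s ∷ S) x →
                       InIntegerCone (s ∷ t ∷ S) (t ℕ.* r ℕ.+ q ℕ.* s ℕ.+ x)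
InIntegerCone-insert {s} t r q (c ∷ cs , len , refl) =
  q ℕ.+ c ∷ r ∷ cs , cong suc len ,
  solve 6 (λ t r q s c Σ → t :* r :+ q :* s :+ (c :* s :+ Σ) := (q :+ c) :* s :+ (r :* t :+ Σ))
          refl t r q s c _
  where open ℕSolver.+-*-Solver

-- Flows on disjoint unions

-- src (G ⊕ H) and tgt (G ⊕ H) are definitionally joinEnds of the endpoint maps of G and H.
joinEnds : ∀ {k₁ k₂ w₁ w₂} → (Fin k₁ → Fin w₁) → (Fin k₂ → Fin w₂) →
           Fin (k₁ ℕ.+ k₂) → Fin (w₁ ℕ.+ w₂)
joinEnds {k₁} {w₁ = w₁} {w₂} end₁ end₂ e =
  [ (λ e₁ → end₁ e₁ ↑ˡ w₂) , (λ e₂ → w₁ ↑ʳ end₂ e₂) ] (splitAt k₁ e)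

module _ (M : AbelianGroup 0ℓ 0ℓ) where
  open AbelianGroup M renaming (Carrier to |M|; refl to ≈-refl)
  open import Algebra.Properties.Monoid.Sum monoid
    using (sum; sum-cong-≗; sum-cong-≋; sum-replicate-zero)
  open import Algebra.Properties.Monoid.Mult monoid using () renaming (_×_ to _·_)
  open import Relation.Binary.Reasoning.Setoid setoid

  Σᴹ≡sum : ∀ {k} (f : Vector |M| k) → Σᴹ M f ≡ sum f
  Σᴹ≡sum {zero}  f = refl
  Σᴹ≡sum {suc k} f = cong (f zero ∙_) (Σᴹ≡sum (tail f))

  Σᴹ-ε : ∀ k → Σᴹ M {k} (λ _ → ε) ≈ ε
  Σᴹ-ε k = trans (reflexive (Σᴹ≡sum {k} (λ _ → ε))) (sum-replicate-zero k)

  incidence : ∀ {k w} → (Fin k → Fin w) → Vector |M| k → Fin w → |M|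
  incidence end φ v = Σᴹ M (λ e → if ⌊ end e ≟ v ⌋ then φ e else ε)

  incidence≡sum : ∀ {k w} (end : Fin k → Fin w) φ v →
                  incidence end φ v ≡ sum (λ e → if ⌊ end e ≟ v ⌋ then φ e else ε)
  incidence≡sum {k} end φ v = Σᴹ≡sum {k} _

  incidence-cong : ∀ {k w} (end : Fin k → Fin w) {φ ψ} → φ ≗ ψ →
                   ∀ v → incidence end φ v ≡ incidence end ψ v
  incidence-cong end {φ} {ψ} φ≗ψ v = ≡.trans (incidence≡sum end φ v) (≡.trans
    (sum-cong-≗ (λ e → cong (λ x → if ⌊ end e ≟ v ⌋ then x else ε) (φ≗ψ e)))
    (≡.sym (incidence≡sum end ψ v)))

  incidence-ε : ∀ {k w} (end : Fin k → Fin w) v → incidence end (λ _ → ε) v ≈ ε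
  incidence-ε {k} end v = begin
    incidence end (λ _ → ε) v                    ≡⟨ incidence≡sum end _ v ⟩
    sum (λ e → if ⌊ end e ≟ v ⌋ then ε else ε)  ≡⟨ sum-cong-≗ (λ e → if-eta ⌊ end e ≟ v ⌋) ⟩
    sum {k} (λ _ → ε)                            ≈⟨ sum-replicate-zero k ⟩
    ε                                            ∎

  module _ {k₁ k₂ w₁ w₂} (end₁ : Fin k₁ → Fin w₁) (end₂ : Fin k₂ → Fin w₂)
           (φ : Vector |M| (k₁ ℕ.+ k₂)) where

    incidence-↑ˡ : ∀ v → incidence (joinEnds end₁ end₂) φ (v ↑ˡ w₂) ≈ incidence end₁ (take k₁ φ) v
    incidence-↑ˡ v = begin
      incidence (joinEnds end₁ end₂) φ (v ↑ˡ w₂)  ≡⟨ incidence≡sum (joinEnds end₁ end₂) φ _ ⟩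
      sum term                                    ≈⟨ sum-take-drop monoid k₁ term ⟩
      sum (take k₁ term) ∙ sum (drop k₁ term)     ≡⟨ cong₂ _∙_ (sum-cong-≗ onLeft) (sum-cong-≗ onRight) ⟩
      sum (λ e → if ⌊ end₁ e ≟ v ⌋ then take k₁ φ e else ε) ∙ sum {k₂} (λ _ → ε)
        ≈⟨ ∙-cong (reflexive (≡.sym (incidence≡sum end₁ (take k₁ φ) v))) (sum-replicate-zero k₂) ⟩
      incidence end₁ (take k₁ φ) v ∙ ε            ≈⟨ identityʳ _ ⟩
      incidence end₁ (take k₁ φ) v                ∎
      where
      term : Vector |M| (k₁ ℕ.+ k₂)
      term e = if ⌊ joinEnds end₁ end₂ e ≟ v ↑ˡ w₂ ⌋ then φ e else ε
      onLeft : ∀ e → term (e ↑ˡ k₂) ≡ (if ⌊ end₁ e ≟ v ⌋ then φ (e ↑ˡ k₂) else ε)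
      onLeft e rewrite splitAt-↑ˡ k₁ e k₂ = cong (λ b → if b then φ (e ↑ˡ k₂) else ε)
                                                 (⌊≟⌋-injective (↑ˡ-injective w₂ _ _) (end₁ e) v)
      onRight : ∀ e → term (k₁ ↑ʳ e) ≡ ε
      onRight e rewrite splitAt-↑ʳ k₁ k₂ e | ⌊≟⌋-≢ (↑ˡ≢↑ʳ v (end₂ e) ∘ ≡.sym) = refl

    incidence-↑ʳ : ∀ v → incidence (joinEnds end₁ end₂) φ (w₁ ↑ʳ v) ≈ incidence end₂ (drop k₁ φ) v
    incidence-↑ʳ v = begin
      incidence (joinEnds end₁ end₂) φ (w₁ ↑ʳ v)  ≡⟨ incidence≡sum (joinEnds end₁ end₂) φ _ ⟩
      sum term                                    ≈⟨ sum-take-drop monoid k₁ term ⟩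
      sum (take k₁ term) ∙ sum (drop k₁ term)     ≡⟨ cong₂ _∙_ (sum-cong-≗ onLeft) (sum-cong-≗ onRight) ⟩
      sum {k₁} (λ _ → ε) ∙ sum (λ e → if ⌊ end₂ e ≟ v ⌋ then drop k₁ φ e else ε)
        ≈⟨ ∙-cong (sum-replicate-zero k₁) (reflexive (≡.sym (incidence≡sum end₂ (drop k₁ φ) v))) ⟩
      ε ∙ incidence end₂ (drop k₁ φ) v            ≈⟨ identityˡ _ ⟩
      incidence end₂ (drop k₁ φ) v                ∎
      where
      term : Vector |M| (k₁ ℕ.+ k₂)
      term e = if ⌊ joinEnds end₁ end₂ e ≟ w₁ ↑ʳ v ⌋ then φ e else ε
      onLeft : ∀ e → term (e ↑ˡ k₂) ≡ ε
      onLeft e rewrite splitAt-↑ˡ k₁ e k₂ | ⌊≟⌋-≢ (↑ˡ≢↑ʳ (end₁ e) v) = refl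
      onRight : ∀ e → term (k₁ ↑ʳ e) ≡ (if ⌊ end₂ e ≟ v ⌋ then φ (k₁ ↑ʳ e) else ε)
      onRight e rewrite splitAt-↑ʳ k₁ k₂ e = cong (λ b → if b then φ (k₁ ↑ʳ e) else ε)
                                                  (⌊≟⌋-injective (↑ʳ-injective w₁ _ _) (end₂ e) v)

  IsFlow-cong : ∀ G {φ ψ} → φ ≗ ψ → IsFlow M G φ → IsFlow M G ψ
  IsFlow-cong G φ≗ψ flow v = begin
    outSum M G _ v  ≡⟨ incidence-cong (src G) φ≗ψ v ⟨
    outSum M G _ v  ≈⟨ flow v ⟩
    inSum M G _ v   ≡⟨ incidence-cong (tgt G) φ≗ψ v ⟩
    inSum M G _ v   ∎

  IsFlow-ε : ∀ G → IsFlow M G (λ _ → ε)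
  IsFlow-ε G v = trans (incidence-ε (src G) v) (sym (incidence-ε (tgt G) v))

  IsFlow-⊕ : ∀ G H (φ : Vector |M| (E (G ⊕ H))) →
             IsFlow M (G ⊕ H) φ ⇔ (IsFlow M G (take (E G) φ) × IsFlow M H (drop (E G) φ))
  IsFlow-⊕ G H φ = mk⇔
    (λ flow → (λ v → trans (sym (outˡ v)) (trans (flow (v ↑ˡ V H)) (inˡ v)))
            , (λ w → trans (sym (outʳ w)) (trans (flow (V G ↑ʳ w)) (inʳ w))))
    (λ (flowG , flowH) → ↑-elim (λ v → outSum M (G ⊕ H) φ v ≈ inSum M (G ⊕ H) φ v)
      (λ v → trans (outˡ v) (trans (flowG v) (sym (inˡ v))))
      (λ w → trans (outʳ w) (trans (flowH w) (sym (inʳ w)))))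
    where
    outˡ : ∀ v → outSum M (G ⊕ H) φ (v ↑ˡ V H) ≈ outSum M G (take (E G) φ) v
    outˡ = incidence-↑ˡ (src G) (src H) φ
    inˡ  : ∀ v → inSum M (G ⊕ H) φ (v ↑ˡ V H) ≈ inSum M G (take (E G) φ) v
    inˡ  = incidence-↑ˡ (tgt G) (tgt H) φ
    outʳ : ∀ w → outSum M (G ⊕ H) φ (V G ↑ʳ w) ≈ outSum M H (drop (E G) φ) w
    outʳ = incidence-↑ʳ (src G) (src H) φ
    inʳ  : ∀ w → inSum M (G ⊕ H) φ (V G ↑ʳ w) ≈ inSum M H (drop (E G) φ) w
    inʳ  = incidence-↑ʳ (tgt G) (tgt H) φ

  IsFlow-++ : ∀ G H {ψ χ} → IsFlow M G ψ → IsFlow M H χ → IsFlow M (G ⊕ H) (ψ ++ χ)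
  IsFlow-++ G H {ψ} {χ} flowG flowH = from (IsFlow-⊕ G H (ψ ++ χ))
    ( IsFlow-cong G (≡.sym ∘ lookup-++ˡ ψ χ) flowG
    , IsFlow-cong H (≡.sym ∘ lookup-++ʳ ψ χ) flowH)

  IsFlow-D⃗ : ∀ a (ψ : Vector |M| a) → IsFlow M (D⃗ a) ψ ⇔ sum ψ ≈ ε
  IsFlow-D⃗ a ψ = mk⇔
    (λ flow → begin
      sum ψ               ≡⟨ Σᴹ≡sum ψ ⟨
      Σᴹ M ψ              ≈⟨ flow zero ⟩
      Σᴹ M {a} (λ _ → ε)  ≈⟨ Σᴹ-ε a ⟩
      ε                   ∎)
    (λ where
      sumψ≈ε zero       → trans (reflexive (Σᴹ≡sum ψ)) (trans sumψ≈ε (sym (Σᴹ-ε a)))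
      sumψ≈ε (suc zero) → trans (Σᴹ-ε a) (trans (sym sumψ≈ε) (reflexive (≡.sym (Σᴹ≡sum ψ)))))

  FlowContinuous-cong : ∀ G H {f g} → f ≗ g → FlowContinuous M G H f → FlowContinuous M G H g
  FlowContinuous-cong G H f≗g fc φ flow = IsFlow-cong G (cong φ ∘ f≗g) (fc φ flow)

  FlowContinuous-⊕ : ∀ G₁ G₂ H f →
                     FlowContinuous M (G₁ ⊕ G₂) H f ⇔
                       (FlowContinuous M G₁ H (take (E G₁) f) × FlowContinuous M G₂ H (drop (E G₁) f))
  FlowContinuous-⊕ G₁ G₂ H f = mk⇔
    (λ fc → (λ φ → proj₁ ∘ to (IsFlow-⊕ G₁ G₂ (φ ∘ f)) ∘ fc φ)
          , (λ φ → proj₂ ∘ to (IsFlow-⊕ G₁ G₂ (φ ∘ f)) ∘ fc φ))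
    (λ (fc₁ , fc₂) φ flow → from (IsFlow-⊕ G₁ G₂ (φ ∘ f)) (fc₁ φ flow , fc₂ φ flow))

  FlowContinuous-↑ˡ : ∀ G H K {f} → FlowContinuous M G H f →
                      FlowContinuous M G (H ⊕ K) (λ e → f e ↑ˡ E K)
  FlowContinuous-↑ˡ G H K fc φ flow = fc (take (E H) φ) (proj₁ (to (IsFlow-⊕ H K φ) flow))

  FlowContinuous-↑ʳ : ∀ G H K {f} → FlowContinuous M G K f →
                      FlowContinuous M G (H ⊕ K) (λ e → E H ↑ʳ f e)
  FlowContinuous-↑ʳ G H K fc φ flow = fc (drop (E H) φ) (proj₂ (to (IsFlow-⊕ H K φ) flow))

  FlowContinuous-D⃗ : ∀ a H g → FlowContinuous M (D⃗ a) H g ⇔ (∀ φ → IsFlow M H φ → sum (φ ∘ g) ≈ ε)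
  FlowContinuous-D⃗ a H g = mk⇔
    (λ fc φ flow → to (IsFlow-D⃗ a (φ ∘ g)) (fc φ flow))
    (λ sum≈ε φ flow → from (IsFlow-D⃗ a (φ ∘ g)) (sum≈ε φ flow))

  FlowContinuousMap : Digraph → Digraph → Set
  FlowContinuousMap G H = Σ (Fin (E G) → Fin (E H)) (FlowContinuous M G H)

  FlowContinuousMap-⨁D⃗ : ∀ A H → FlowContinuousMap (⨁D⃗ A) H ⇔ All (λ a → FlowContinuousMap (D⃗ a) H) A
  FlowContinuousMap-⨁D⃗ []      H = mk⇔ (λ _ → []) (λ _ → (λ ()) , λ _ _ ())
  FlowContinuousMap-⨁D⃗ (a ∷ A) H = mk⇔
    (λ (f , fc) → let fc₁ , fc₂ = to (FlowContinuous-⊕ (D⃗ a) (⨁D⃗ A) H f) fc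
                  in (take a f , fc₁) ∷ to IH (drop a f , fc₂))
    (λ { ((g , fc₁) ∷ gs) → let f , fc₂ = from IH gs
                            in g ++ f , from (FlowContinuous-⊕ (D⃗ a) (⨁D⃗ A) H (g ++ f))
                                 ( FlowContinuous-cong (D⃗ a) H (≡.sym ∘ lookup-++ˡ g f) fc₁
                                 , FlowContinuous-cong (⨁D⃗ A) H (≡.sym ∘ lookup-++ʳ g f) fc₂) })
    where
    IH : FlowContinuousMap (⨁D⃗ A) H ⇔ All (λ a → FlowContinuousMap (D⃗ a) H) A
    IH = FlowContinuousMap-⨁D⃗ A H

  FlowContinuousMap-D⃗-0 : ∀ H → FlowContinuousMap (D⃗ 0) H
  FlowContinuousMap-D⃗-0 H = (λ ()) , λ _ _ _ → ≈-refl

  FlowContinuousMap-D⃗-+ : ∀ {a b} H → FlowContinuousMap (D⃗ a) H → FlowContinuousMap (D⃗ b) H →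
                          FlowContinuousMap (D⃗ (a ℕ.+ b)) H
  FlowContinuousMap-D⃗-+ {a} {b} H (g , fc) (g′ , fc′) =
    g ++ g′ , from (FlowContinuous-D⃗ (a ℕ.+ b) H (g ++ g′)) λ φ flow → begin
      sum (φ ∘ (g ++ g′))
        ≈⟨ sum-take-drop monoid a (φ ∘ (g ++ g′)) ⟩
      sum (take a (φ ∘ (g ++ g′))) ∙ sum (drop a (φ ∘ (g ++ g′)))
        ≡⟨ cong₂ _∙_ (sum-cong-≗ (cong φ ∘ lookup-++ˡ g g′)) (sum-cong-≗ (cong φ ∘ lookup-++ʳ g g′)) ⟩
      sum (φ ∘ g) ∙ sum (φ ∘ g′)
        ≈⟨ ∙-cong (to (FlowContinuous-D⃗ a H g) fc φ flow) (to (FlowContinuous-D⃗ b H g′) fc′ φ flow) ⟩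
      ε ∙ ε
        ≈⟨ identityˡ ε ⟩
      ε ∎

  FlowContinuousMap-D⃗-blocks : ∀ B → All (λ b → FlowContinuousMap (D⃗ b) (⨁D⃗ B)) B
  FlowContinuousMap-D⃗-blocks []      = []
  FlowContinuousMap-D⃗-blocks (b ∷ B) =
    ((λ e → e ↑ˡ E (⨁D⃗ B)) , FlowContinuous-↑ˡ (D⃗ b) (D⃗ b) (⨁D⃗ B) (λ _ flow → flow))
    ∷ All.map (λ {b′} (g , fc) → (λ e → b ↑ʳ g e) , FlowContinuous-↑ʳ (D⃗ b′) (D⃗ b) (⨁D⃗ B) fc)
              (FlowContinuousMap-D⃗-blocks B)

  Orthogonal : ∀ H → Vector ℕ (E H) → Set
  Orthogonal H c = ∀ φ → IsFlow M H φ → sum (λ e → c e · φ e) ≈ ε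

  FlowContinuous-D⃗⇒Orthogonal : ∀ a H g → FlowContinuous M (D⃗ a) H g → Orthogonal H (fibreSize g)
  FlowContinuous-D⃗⇒Orthogonal a H g fc φ flow =
    trans (sym (sum-∘-fibreSize commutativeMonoid φ g)) (to (FlowContinuous-D⃗ a H g) fc φ flow)

  Orthogonal-⊕ : ∀ G H c → Orthogonal (G ⊕ H) c →
                 Orthogonal G (take (E G) c) × Orthogonal H (drop (E G) c)
  Orthogonal-⊕ G H c orth =
    (λ ψ flow → begin
      sum (λ e → cˡ e · ψ e)                             ≈⟨ identityʳ _ ⟨
      sum (λ e → cˡ e · ψ e) ∙ ε                         ≈⟨ ∙-congˡ (sum-·-ε cʳ) ⟨
      sum (λ e → cˡ e · ψ e) ∙ sum (λ e → cʳ e · ε)     ≈⟨ pairing ψ (λ _ → ε) ⟨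
      sum (λ e → c e · (ψ ++ (λ _ → ε)) e)               ≈⟨ orth _ (IsFlow-++ G H flow (IsFlow-ε H)) ⟩
      ε                                                  ∎) ,
    (λ χ flow → begin
      sum (λ e → cʳ e · χ e)                             ≈⟨ identityˡ _ ⟨
      ε ∙ sum (λ e → cʳ e · χ e)                         ≈⟨ ∙-congʳ (sum-·-ε cˡ) ⟨
      sum (λ e → cˡ e · ε) ∙ sum (λ e → cʳ e · χ e)     ≈⟨ pairing (λ _ → ε) χ ⟨
      sum (λ e → c e · ((λ _ → ε) ++ χ) e)               ≈⟨ orth _ (IsFlow-++ G H (IsFlow-ε G) flow) ⟩
      ε                                                  ∎)
    where
    cˡ : Vector ℕ (E G)
    cˡ = take (E G) c
    cʳ : Vector ℕ (E H)
    cʳ = drop (E G) c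
    sum-·-ε : ∀ {k} (d : Vector ℕ k) → sum (λ e → d e · ε) ≈ ε
    sum-·-ε {k} d = trans (sum-cong-≋ (·-ε monoid ∘ d)) (sum-replicate-zero k)
    pairing : ∀ ψ χ → sum (λ e → c e · (ψ ++ χ) e) ≈ sum (λ e → cˡ e · ψ e) ∙ sum (λ e → cʳ e · χ e)
    pairing ψ χ = trans (sum-take-drop monoid (E G) (λ e → c e · (ψ ++ χ) e)) (reflexive (cong₂ _∙_
      (sum-cong-≗ (λ e → cong (cˡ e ·_) (lookup-++ˡ ψ χ e)))
      (sum-cong-≗ (λ e → cong (cʳ e ·_) (lookup-++ʳ ψ χ e)))))

-- Integers modulo n

open import Algebra.Properties.Monoid.Sum ℤP.+-0-monoid using ()
  renaming (sum to ∑ℤ; sum-cong-≗ to ∑ℤ-cong; sum-replicate to ∑ℤ-replicate)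
open import Algebra.Properties.Monoid.Mult ℤP.+-0-monoid using () renaming (_×_ to _·ℤ_)

·ℤ≡* : ∀ m x → m ·ℤ x ≡ + m ℤ.* x
·ℤ≡* zero    x = refl
·ℤ≡* (suc m) x = ≡.trans (cong (λ t → x ℤ.+ t) (·ℤ≡* m x)) (≡.sym (ℤP.suc-* (+ m) x))

∑ℤ-sub : ∀ {k} (f g : Vector ℤ k) → ∑ℤ (λ e → f e ℤ.- g e) ≡ ∑ℤ f ℤ.- ∑ℤ g
∑ℤ-sub {zero}  f g = refl
∑ℤ-sub {suc k} f g = ≡.trans (cong (λ t → f zero ℤ.- g zero ℤ.+ t) (∑ℤ-sub (tail f) (tail g)))
  (solve 4 (λ a b c d → (a :- b) :+ (c :- d) := (a :+ c) :- (b :+ d))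
           refl (f zero) (g zero) (∑ℤ (tail f)) (∑ℤ (tail g)))
  where open +-*-Solver

∑ℤ-δ-* : ∀ {k} (x : Fin k) (w : Vector ℤ k) → ∑ℤ (λ e → + δ x e ℤ.* w e) ≡ w x
∑ℤ-δ-* x w = ≡.trans (∑ℤ-cong (λ e → ≡.sym (·ℤ≡* (δ x e) (w e)))) (sum-δ-· ℤP.+-0-monoid x w)

module _ (n : ℕ) .{{_ : ℕ.NonZero n}} where
  open AbelianGroup (ℤ/ n) using (_≈_; ε; reflexive; monoid)
  open import Algebra.Properties.Monoid.Mult monoid using () renaming (_×_ to _·_)

  -- ℤ/ n and ℤ share carrier, addition and zero, so their sums agree definitionally,
  -- but their multiples do not: the two raw monoids differ in their equality.
  ·≡·ℤ : ∀ m x → m · x ≡ m ·ℤ x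
  ·≡·ℤ zero    x = refl
  ·≡·ℤ (suc m) x = cong (λ t → x ℤ.+ t) (·≡·ℤ m x)

  ∑ℤ-replicate-modulus : ∀ x → ∑ℤ {n} (λ _ → x) ≈ ε
  ∑ℤ-replicate-modulus x = x , (begin
    ∑ℤ {n} (λ _ → x) ℤ.- + 0  ≡⟨ ℤP.+-identityʳ _ ⟩
    ∑ℤ {n} (λ _ → x)          ≡⟨ ∑ℤ-replicate n ⟩
    n ·ℤ x                    ≡⟨ ·ℤ≡* n x ⟩
    + n ℤ.* x                 ≡⟨ ℤP.*-comm (+ n) x ⟩
    x ℤ.* + n                 ∎)
    where open ≡-Reasoning

  x-y≈ε⇒x%n≡y%n : ∀ x y → (+ x ℤ.- + y) ≈ ε → x % n ≡ y % n
  x-y≈ε⇒x%n≡y%n x y (k , eq) = bySign k (≡.trans (≡.sym (ℤP.+-identityʳ _)) eq)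
    where
    open ≡-Reasoning
    open +-*-Solver
    a≡b+kn⇒a%n≡b%n : ∀ a b k → + a ≡ + b ℤ.+ + k ℤ.* + n → a % n ≡ b % n
    a≡b+kn⇒a%n≡b%n a b k a≡b+kn = begin
      a % n                ≡⟨ cong (_% n) (ℤP.+-injective (≡.trans a≡b+kn
                                (cong (λ t → + b ℤ.+ t) (≡.sym (ℤP.pos-* k n))))) ⟩
      (b ℕ.+ k ℕ.* n) % n  ≡⟨ [m+kn]%n≡m%n b k n ⟩
      b % n                ∎
    bySign : ∀ k → + x ℤ.- + y ≡ k ℤ.* + n → x % n ≡ y % n
    bySign (+ k)    x-y≡kn = a≡b+kn⇒a%n≡b%n x y k (begin
      + x                       ≡⟨ solve 2 (λ x y → x := y :+ (x :- y)) refl (+ x) (+ y) ⟩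
      + y ℤ.+ (+ x ℤ.- + y)     ≡⟨ cong (λ t → + y ℤ.+ t) x-y≡kn ⟩
      + y ℤ.+ + k ℤ.* + n       ∎)
    bySign -[1+ k ] x-y≡kn = ≡.sym (a≡b+kn⇒a%n≡b%n y x (suc k) (begin
      + y                       ≡⟨ solve 2 (λ x y → y := x :- (x :- y)) refl (+ x) (+ y) ⟩
      + x ℤ.- (+ x ℤ.- + y)     ≡⟨ cong (λ t → + x ℤ.- t) x-y≡kn ⟩
      + x ℤ.- -[1+ k ] ℤ.* + n  ≡⟨ cong (λ t → + x ℤ.+ t) (ℤP.neg-distribˡ-* -[1+ k ] (+ n)) ⟩
      + x ℤ.+ + suc k ℤ.* + n   ∎))

  sum-%-constant : ∀ {b} (c : Vector ℕ b) r → (∀ j → c j % n ≡ r) →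
                   ∑ℕ c ≡ b ℕ.* r ℕ.+ ∑ℕ (λ j → c j / n) ℕ.* n
  sum-%-constant {b} c r c%n≡r = begin
    ∑ℕ c
      ≡⟨ ∑ℕ-cong (λ j → ≡.trans (m≡m%n+[m/n]*n (c j) n) (cong (ℕ._+ c j / n ℕ.* n) (c%n≡r j))) ⟩
    ∑ℕ (λ j → r ℕ.+ c j / n ℕ.* n)
      ≡⟨ ∑-distrib-+ (λ _ → r) (λ j → c j / n ℕ.* n) ⟩
    ∑ℕ {b} (λ _ → r) ℕ.+ ∑ℕ (λ j → c j / n ℕ.* n)
      ≡⟨ cong₂ ℕ._+_ (∑ℕ-const b r) (≡.sym (*-distribʳ-sum n (λ j → c j / n))) ⟩
    b ℕ.* r ℕ.+ ∑ℕ (λ j → c j / n) ℕ.* n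
      ∎
    where
    open ≡-Reasoning
    open import Algebra.Properties.CommutativeMonoid.Sum ℕP.+-0-commutativeMonoid using (∑-distrib-+)
    open import Algebra.Properties.Semiring.Sum ℕP.+-*-semiring using (*-distribʳ-sum)

  Orthogonal-D⃗⇒%-constant : ∀ {b} (c : Vector ℕ b) → Orthogonal (ℤ/ n) (D⃗ b) c →
                             ∀ i j → c i % n ≡ c j % n
  Orthogonal-D⃗⇒%-constant {b} c orth i j =
    x-y≈ε⇒x%n≡y%n (c i) (c j) (subst (_≈ ε) (pairing c) (orth ψ ψ-flow))
    where
    open ≡-Reasoning
    ψ : Vector ℤ b
    ψ e = + δ i e ℤ.- + δ j e
    pairing : ∀ w → ∑ℤ (λ e → w e · ψ e) ≡ + w i ℤ.- + w j
    pairing w = begin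
      ∑ℤ (λ e → w e · ψ e)
        ≡⟨ ∑ℤ-cong (λ e → ≡.trans (·≡·ℤ (w e) (ψ e)) (·ℤ≡* (w e) (ψ e))) ⟩
      ∑ℤ (λ e → + w e ℤ.* ψ e)
        ≡⟨ ∑ℤ-cong (λ e → distrib (+ w e) (+ δ i e) (+ δ j e)) ⟩
      ∑ℤ (λ e → + δ i e ℤ.* + w e ℤ.- + δ j e ℤ.* + w e)
        ≡⟨ ∑ℤ-sub (λ e → + δ i e ℤ.* + w e) (λ e → + δ j e ℤ.* + w e) ⟩
      ∑ℤ (λ e → + δ i e ℤ.* + w e) ℤ.- ∑ℤ (λ e → + δ j e ℤ.* + w e)
        ≡⟨ cong₂ ℤ._-_ (∑ℤ-δ-* i (+_ ∘ w)) (∑ℤ-δ-* j (+_ ∘ w)) ⟩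
      + w i ℤ.- + w j
        ∎
      where
      open +-*-Solver
      distrib : ∀ x a b → x ℤ.* (a ℤ.- b) ≡ a ℤ.* x ℤ.- b ℤ.* x
      distrib = solve 3 (λ x a b → x :* (a :- b) := a :* x :- b :* x) refl
    ψ-flow : IsFlow (ℤ/ n) (D⃗ b) ψ
    ψ-flow = from (IsFlow-D⃗ (ℤ/ n) b ψ)
      (reflexive (≡.trans (∑ℤ-cong (λ e → ≡.sym (ℤP.+-identityʳ (ψ e)))) (pairing (λ _ → 1))))

  Orthogonal-⨁D⃗⇒InIntegerCone : ∀ B → All (1 ≤_) B → (c : Vector ℕ (E (⨁D⃗ B))) →
                                  Orthogonal (ℤ/ n) (⨁D⃗ B) c → InIntegerCone (n ∷ B) (∑ℕ c)
  Orthogonal-⨁D⃗⇒InIntegerCone []      []               c _    = 0 ∷ [] , refl , refl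
  Orthogonal-⨁D⃗⇒InIntegerCone (b ∷ B) (s≤s z≤n ∷ B≥1) c orth =
    subst (InIntegerCone (n ∷ b ∷ B)) (≡.sym ∑c≡)
      (InIntegerCone-insert b r q (Orthogonal-⨁D⃗⇒InIntegerCone B B≥1 (drop b c) orthʳ))
    where
    orthˡ : Orthogonal (ℤ/ n) (D⃗ b) (take b c)
    orthˡ = proj₁ (Orthogonal-⊕ (ℤ/ n) (D⃗ b) (⨁D⃗ B) c orth)
    orthʳ : Orthogonal (ℤ/ n) (⨁D⃗ B) (drop b c)
    orthʳ = proj₂ (Orthogonal-⊕ (ℤ/ n) (D⃗ b) (⨁D⃗ B) c orth)
    q r : ℕ
    q = ∑ℕ (λ j → take b c j / n)
    r = take b c zero % n
    ∑c≡ : ∑ℕ c ≡ b ℕ.* r ℕ.+ q ℕ.* n ℕ.+ ∑ℕ (drop b c)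
    ∑c≡ = ≡.trans (sum-take-drop ℕP.+-0-monoid b c) (cong (ℕ._+ ∑ℕ (drop b c))
      (sum-%-constant (take b c) r (λ j → Orthogonal-D⃗⇒%-constant (take b c) orthˡ j zero)))

  FlowContinuousMap-D⃗-modulus : ∀ H → Fin (E H) → FlowContinuousMap (ℤ/ n) (D⃗ n) H
  FlowContinuousMap-D⃗-modulus H e = (λ _ → e) ,
    from (FlowContinuous-D⃗ (ℤ/ n) n H (λ _ → e)) (λ φ _ → ∑ℤ-replicate-modulus (φ e))

  FlowContinuousMap-D⃗⇔InIntegerCone : ∀ B → B ≢ [] → All (1 ≤_) B → ∀ a →
    FlowContinuousMap (ℤ/ n) (D⃗ a) (⨁D⃗ B) ⇔ InIntegerCone (n ∷ B) a
  FlowContinuousMap-D⃗⇔InIntegerCone B B≢[] B≥1 a = mk⇔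
    (λ (g , fc) → subst (InIntegerCone (n ∷ B)) (sum-fibreSize g)
      (Orthogonal-⨁D⃗⇒InIntegerCone B B≥1 (fibreSize g) (FlowContinuous-D⃗⇒Orthogonal (ℤ/ n) a (⨁D⃗ B) g fc)))
    (InIntegerCone-closed (FlowContinuousMap-D⃗-0 (ℤ/ n) (⨁D⃗ B)) (FlowContinuousMap-D⃗-+ (ℤ/ n) (⨁D⃗ B))
      (FlowContinuousMap-D⃗-modulus (⨁D⃗ B) (anEdge B B≢[] B≥1) ∷ FlowContinuousMap-D⃗-blocks (ℤ/ n) B))
    where
    anEdge : ∀ B → B ≢ [] → All (1 ≤_) B → Fin (E (⨁D⃗ B))
    anEdge []          B≢[] _             = ⊥-elim (B≢[] refl)
    anEdge (suc b ∷ B) _    (s≤s z≤n ∷ _) = zero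

lemma2p8 : (A B : List ℕ) (n : ℕ) →
  Unique A → A ≢ [] → All (1 ≤_) A →
  Unique B → B ≢ [] → All (1 ≤_) B →
  1 ≤ n →
  Σ (Fin (E (⨁D⃗ A)) → Fin (E (⨁D⃗ B))) (FlowContinuous (ℤ/ n) (⨁D⃗ A) (⨁D⃗ B))
    ⇔ All (InIntegerCone (n ∷ B)) A
lemma2p8 A B n@(suc _) _ _ _ _ B≢[] B≥1 _ =
  mk⇔ (All.map (to (perBlock _))) (All.map (from (perBlock _)))
    ⇔-∘ FlowContinuousMap-⨁D⃗ (ℤ/ n) A (⨁D⃗ B)
  where
  perBlock : ∀ a → FlowContinuousMap (ℤ/ n) (D⃗ a) (⨁D⃗ B) ⇔ InIntegerCone (n ∷ B) a
  perBlock = FlowContinuousMap-D⃗⇔InIntegerCone n B B≢[] B≥1
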